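{- Let $(E,\chi,m)$ be an oriented arithmetic matroid of rank $r$ and let $A\subseteq E$. Then the triple $(E\setminus A,\ \chi\setminus A,\ m\setminus A)$ is an oriented arithmetic matroid.
   Context: $E$ is a finite totally ordered set. An oriented arithmetic matroid $(E,\chi,m)$ consists of a matroid $(E,\mathrm{rk})$ of rank $r$, a chirotope $\chi:E^r\to\{ -1,0,1\}$ (non-identically zero, alternating, satisfying the chirotope exchange axiom) whose associated unoriented matroid (bases = sets $\{b_1,\dots,b_r\}$ with $\chi(b_1,\dots,b_r)\neq 0$) is $(E,\mathrm{rk})$, and a multiplicity function $m:\mathcal P(E)\to\{1,2,3,\dots\}$ such that $(E,\mathrm{rk},m)$ is an arithmetic matroid, and such that for all $x_2,\dots,x_r\in E$ and all $y_0,\dots,y_r\in E$ $$\sum_{i=0}^r(-1)^i\chi(\underline{x}_i)m(\underline{x}_i)\chi(\underline{y}^i)m(\underline{y}^i)=0,$$ where $\underline{x}_i=(y_i,x_2,\dots,x_r)$ and $\underline{y}^i=(y_0,\dots,y_{i-1},y_{i+1},\dots,y_r)$ (a Grassmann–Plücker-type relation). The deletion is defined as follows: let $s$ be the rank of $E\setminus A$ and choose $\underline f=(a_1,\dots,a_{r-s})$ in $A$ with $\mathrm{rk}((E\setminus A)\cup\underline f)=r$; then $(\chi\setminus A)(\underline z)=\chi(\underline z,\underline f)$ for $\underline z\in(E\setminus A)^s$, $m\setminus A$ is the restriction of $m$ to subsets of $E\setminus A$, and the underlying matroid is the usual matroid deletion of $A$. (The triple is an arithmetic matroid with a chirotope for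 the deleted matroid by the known deletion operations for arithmetic and oriented matroids; the content is the compatibility relation.) -}

module Defs where

open import Data.Nat using (ℕ; zero; suc; _+_; _∸_; _≤_)
open import Data.Integer as ℤ using (ℤ; +_; -_; _*_)
open import Data.Fin as Fin using (Fin; toℕ)
open import Data.Fin.Subset
  using (Subset; _∈_; _∉_; _⊆_; _∪_; _∩_; ∁; ⁅_⁆; ∣_∣)
  renaming (⊥ to ∅)
open import Data.Fin.Subset.Properties using (_⊆?_)
import Data.Nat as ℕ
open import Data.Nat.Divisibility using (_∣_)
open import Data.Vec as Vec using (Vec; []; _∷_; lookup; _[_]≔_; removeAt; cast)
open import Data.Vec.Relation.Unary.All using (All)
open import Data.List as List using (List; []; _∷_; _++_; map; foldr; allFin)
open import Data.Bool using (Bool; true; false)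
open import Data.Product using (_×_; ∃; Σ-syntax)
open import Data.Sum using (_⊎_)
open import Data.Unit using () renaming (⊤ to Unit)
open import Relation.Nullary using (¬_; yes; no)
open import Relation.Binary.PropositionalEquality using (_≡_; _≢_)

-- The finite totally ordered set E is Fin n (with its natural order).
-- A (possibly deleted) structure lives on a ground set G ⊆ Fin n: all
-- axioms are only imposed on subsets of G / tuples of elements of G, so
-- functions defined on all of Fin n are regarded as functions on G.
-- In particular restriction of rk and m to subsets of G is implicit.

toSet : ∀ {n k} → Vec (Fin n) k → Subset n
toSet []       = ∅
toSet (x ∷ xs) = ⁅ x ⁆ ∪ toSet xs

InG : ∀ {n k} → Subset n → Vec (Fin n) k → Set
InG G x = All (_∈ G) x

sgnPow : ℕ → ℤ
sgnPow zero    = + 1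
sgnPow (suc k) = - sgnPow k

sumℤ : List ℤ → ℤ
sumℤ = foldr ℤ._+_ (+ 0)

allSubsets : ∀ n → List (Subset n)
allSubsets zero    = Vec.[] ∷ []
allSubsets (suc n) =
  map (false Vec.∷_) (allSubsets n) ++ map (true Vec.∷_) (allSubsets n)

interval : ∀ {n} → Subset n → Subset n → List (Subset n)
interval {n} R B = List.filter (λ S → R ⊆? S) (List.filter (λ S → S ⊆? B) (allSubsets n))

record IsMatroid {n} (G : Subset n) (rk : Subset n → ℕ) : Set where
  field
    rk-bounded : ∀ X → X ⊆ G → rk X ≤ ∣ X ∣
    rk-mono    : ∀ X Y → Y ⊆ G → X ⊆ Y → rk X ≤ rk Y
    rk-submod  : ∀ X Y → X ⊆ G → Y ⊆ G →
                 rk (X ∪ Y) + rk (X ∩ Y) ≤ rk X + rk Y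

record IsMolecule {n} (G : Subset n) (rk : Subset n → ℕ)
                  (R F T : Subset n) : Set where
  field
    R⊆G : R ⊆ G
    F⊆G : F ⊆ G
    T⊆G : T ⊆ G
    RF-disj : R ∩ F ≡ ∅
    RT-disj : R ∩ T ≡ ∅
    FT-disj : F ∩ T ≡ ∅
    rank-cond : ∀ F' T' → F' ⊆ F → T' ⊆ T →
                rk (R ∪ F' ∪ T') ≡ rk R + ∣ F' ∣

-- ρ(R, R ∪ F ∪ T) = (-1)^{|T|} Σ_{R ⊆ S ⊆ R∪F∪T} (-1)^{|R∪F∪T| - |S|} m(S)
ρ : ∀ {n} → (Subset n → ℕ) → Subset n → Subset n → Subset n → ℤ
ρ m R F T =
  sgnPow ∣ T ∣ *
  sumℤ (map (λ S → sgnPow (∣ B ∣ ∸ ∣ S ∣) * + m S) (interval R B))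
  where B = R ∪ F ∪ T

record IsArithmeticMatroid {n} (G : Subset n) (rk : Subset n → ℕ)
                           (m : Subset n → ℕ) : Set where
  field
    matroid  : IsMatroid G rk
    m-pos    : ∀ X → X ⊆ G → 1 ≤ m X
    A1-dep   : ∀ X e → X ⊆ G → e ∈ G →
               rk (X ∪ ⁅ e ⁆) ≡ rk X → m (X ∪ ⁅ e ⁆) ∣ m X
    A1-indep : ∀ X e → X ⊆ G → e ∈ G →
               rk (X ∪ ⁅ e ⁆) ≢ rk X → m X ∣ m (X ∪ ⁅ e ⁆)
    A2 : ∀ R F T → IsMolecule G rk R F T →
         m R ℕ.* m (R ∪ F ∪ T) ≡ m (R ∪ F) ℕ.* m (R ∪ T)
    P  : ∀ R F T → IsMolecule G rk R F T → + 0 ℤ.≤ ρ m R F T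

Exchange : ∀ {n} (G : Subset n) r → (Vec (Fin n) r → ℤ) → Set
Exchange G zero    χ = Unit   -- vacuous (χ()·χ() ≥ 0 holds trivially)
Exchange {n} G (suc k) χ =
  ∀ (x y : Vec (Fin n) (suc k)) → InG G x → InG G y →
  (∀ (i : Fin (suc k)) →
     + 0 ℤ.≤ χ (x [ Fin.zero ]≔ lookup y i) * χ (y [ i ]≔ lookup x Fin.zero)) →
  + 0 ℤ.≤ χ x * χ y

record IsChirotope {n} (G : Subset n) (r : ℕ) (χ : Vec (Fin n) r → ℤ) : Set where
  field
    values      : ∀ x → InG G x → (χ x ≡ + 1) ⊎ (χ x ≡ + 0) ⊎ (χ x ≡ - + 1)
    nonzero     : ∃ λ x → InG G x × χ x ≢ + 0
    alternating : ∀ x → InG G x → ∀ (i j : Fin r) → i ≢ j →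
                  χ ((x [ i ]≔ lookup x j) [ j ]≔ lookup x i) ≡ - χ x
    exchange    : Exchange G r χ

IsBasis : ∀ {n} (G : Subset n) (rk : Subset n → ℕ) → Subset n → Set
IsBasis G rk B = B ⊆ G × ∣ B ∣ ≡ rk G × rk B ≡ rk G

UnderlyingMatroid : ∀ {n} (G : Subset n) (rk : Subset n → ℕ) →
                    (Vec (Fin n) (rk G) → ℤ) → Set
UnderlyingMatroid G rk χ =
  ∀ x → InG G x → (χ x ≢ + 0 → IsBasis G rk (toSet x))
                × (IsBasis G rk (toSet x) → χ x ≢ + 0)

-- for all x₂..x_r and y₀..y_r in G:
-- Σ_{i=0}^r (-1)^i χ(y_i,x₂..x_r) m(y_i,x₂..x_r) χ(y^i) m(y^i) = 0
GPRelation : ∀ {n} (G : Subset n) r → (Vec (Fin n) r → ℤ) →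
             (Subset n → ℕ) → Set
GPRelation G zero    χ m = Unit   -- r = 0: no such relation
GPRelation {n} G (suc k) χ m =
  ∀ (xs : Vec (Fin n) k) (y : Vec (Fin n) (suc (suc k))) →
  InG G xs → InG G y →
  sumℤ (map (λ i →
      sgnPow (toℕ i)
      * χ (lookup y i ∷ xs) * + m (toSet (lookup y i ∷ xs))
      * χ (removeAt y i)    * + m (toSet (removeAt y i)))
    (allFin (suc (suc k))))
  ≡ + 0

record IsOrientedArithmeticMatroid {n} (G : Subset n) (rk : Subset n → ℕ)
       (χ : Vec (Fin n) (rk G) → ℤ) (m : Subset n → ℕ) : Set where
  field
    arithmetic : IsArithmeticMatroid G rk m
    chirotope  : IsChirotope G (rk G) χ
    underlying : UnderlyingMatroid G rk χ
    gp         : GPRelation G (rk G) χ m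

-- Deletion of the chirotope: (χ \ A)(z) = χ(z, f) where f is a tuple of
-- length k with s + k = r (s = rk (E∖A)).

deleteχ : ∀ {n} {s k r : ℕ} → s + k ≡ r → Vec (Fin n) k →
          (Vec (Fin n) r → ℤ) → Vec (Fin n) s → ℤ
deleteχ eq f χ z = χ (cast eq (z Vec.++ f))

module Submission where

-- Let S = E ∖ A be the new ground set and F the entry set of the padding
-- tuple f, so that rk S + k = rk E and S ∪ F spans E.  The arithmetic axioms
-- restrict to any subset of the ground set, and values, alternation and
-- exchange survive appending f, because moving an entry of f to the front
-- repeats an entry and an alternating map vanishes there.  The content lies
-- in ranks and multiplicities: F is independent over S, so Z ⊆ S is a basis
-- of S iff Z ∪ F is a basis of E (the underlying matroid of χ ∖ A); for such
-- Z the triple (Z, F, S ∖ Z) is a molecule, and (A2) gives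
-- m(Z) m(S ∪ F) = m(Z ∪ F) m(S).  Hence m(S ∪ F)² times the Grassmann–Plücker
-- sum of χ ∖ A equals m(S)² times that of χ at (xs ++ f, y ++ f), whose extra
-- terms vanish.

open import Defs
open import Data.Nat as ℕ using (ℕ; zero; suc; _+_; _≤_; z≤n; s≤s)
open import Data.Nat.Properties as ℕₚ using (≤-trans; ≤-reflexive; ≤-antisym)
open import Data.Integer as ℤ using (ℤ; +_; -_; -[1+_]; _*_)
import Data.Integer.Properties as ℤₚ
open import Data.Integer.Tactic.RingSolver using (solve-∀)
open import Data.Fin as Fin using (Fin; toℕ; _↑ˡ_; _↑ʳ_; splitAt; join)
open import Data.Fin.Properties using (↑ˡ-injective; join-splitAt; toℕ-↑ˡ)
open import Data.Fin.Subset
  using (Subset; _∈_; _∉_; _⊆_; _∪_; _∩_; _─_; ∁; ⁅_⁆; ∣_∣; ⊤; inside; outside)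
  renaming (⊥ to ∅)
open import Data.Fin.Subset.Properties
open import Data.Vec as Vec using (Vec; []; _∷_; here; lookup; _[_]≔_; removeAt; cast; _++_)
open import Data.Vec.Properties using (cast-is-id; lookup-++ˡ; lookup-++ʳ; []≔-++-↑ˡ; []≔-lookup)
open import Data.Vec.Relation.Unary.All as All using (All; []; _∷_)
open import Data.Vec.Relation.Unary.All.Properties using (lookup⁺)
import Data.Vec.Relation.Unary.Any as Any
open import Data.Vec.Membership.Propositional using () renaming (_∈_ to _∈ᵥ_)
open import Data.Vec.Membership.Propositional.Properties using (∈-allFin⁺)
import Data.List as List
open import Data.List.Properties using (map-tabulate)
open import Algebra.Properties.Semiring.Sum ℤₚ.+-*-semiring
  using (sum; sum-cong-≗; sum-replicate-zero; *-distribʳ-sum)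
open import Data.Sum using (inj₁; inj₂; [_,_]′)
open import Data.Product using (_×_; _,_; proj₁; proj₂; Σ; ∃)
open import Data.Unit using (tt)
open import Function using (_∘_)
open import Relation.Nullary using (¬_; yes; no; contradiction)
open import Relation.Binary.PropositionalEquality

∪-lub : ∀ {n} {P Q R : Subset n} → P ⊆ R → Q ⊆ R → P ∪ Q ⊆ R
∪-lub {P = P} {Q} P⊆R Q⊆R x∈P∪Q = [ P⊆R , Q⊆R ]′ (x∈p∪q⁻ P Q x∈P∪Q)

∪-mono : ∀ {n} {P P′ Q Q′ : Subset n} → P ⊆ P′ → Q ⊆ Q′ → P ∪ Q ⊆ P′ ∪ Q′
∪-mono {P′ = P′} {Q′ = Q′} P⊆P′ Q⊆Q′ =
  ∪-lub (λ x∈P → p⊆p∪q Q′ (P⊆P′ x∈P)) (λ x∈Q → q⊆p∪q P′ Q′ (Q⊆Q′ x∈Q))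

⊆⇒∪≡ : ∀ {n} {P Q : Subset n} → P ⊆ Q → P ∪ Q ≡ Q
⊆⇒∪≡ {P = P} {Q} P⊆Q = ⊆-antisym (∪-lub P⊆Q ⊆-refl) (q⊆p∪q P Q)

disjoint⇒∩≡∅ : ∀ {n} {P Q : Subset n} → (∀ {x} → x ∈ P → x ∉ Q) → P ∩ Q ≡ ∅
disjoint⇒∩≡∅ {P = P} {Q} disjoint =
  Empty-unique λ (_ , x∈P∩Q) → let (x∈P , x∈Q) = x∈p∩q⁻ P Q x∈P∩Q in disjoint x∈P x∈Q

∣p∪q∣≤∣p∣+∣q∣ : ∀ {n} (p q : Subset n) → ∣ p ∪ q ∣ ≤ ∣ p ∣ + ∣ q ∣
∣p∪q∣≤∣p∣+∣q∣ []            []            = z≤n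
∣p∪q∣≤∣p∣+∣q∣ (inside ∷ p)  (inside ∷ q)  =
  s≤s (≤-trans (∣p∪q∣≤∣p∣+∣q∣ p q) (≤-trans (ℕₚ.n≤1+n _) (≤-reflexive (sym (ℕₚ.+-suc ∣ p ∣ ∣ q ∣)))))
∣p∪q∣≤∣p∣+∣q∣ (inside ∷ p)  (outside ∷ q) = s≤s (∣p∪q∣≤∣p∣+∣q∣ p q)
∣p∪q∣≤∣p∣+∣q∣ (outside ∷ p) (inside ∷ q)  =
  ≤-trans (s≤s (∣p∪q∣≤∣p∣+∣q∣ p q)) (≤-reflexive (sym (ℕₚ.+-suc ∣ p ∣ ∣ q ∣)))
∣p∪q∣≤∣p∣+∣q∣ (outside ∷ p) (outside ∷ q) = ∣p∪q∣≤∣p∣+∣q∣ p q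

∣p∣+∣q─p∣≤∣q∣ : ∀ {n} {p q : Subset n} → p ⊆ q → ∣ p ∣ + ∣ q ─ p ∣ ≤ ∣ q ∣
∣p∣+∣q─p∣≤∣q∣ {p = []}          {[]}          _   = z≤n
∣p∣+∣q─p∣≤∣q∣ {p = inside ∷ p}  {inside ∷ q}  p⊆q = s≤s (∣p∣+∣q─p∣≤∣q∣ (drop-∷-⊆ p⊆q))
∣p∣+∣q─p∣≤∣q∣ {p = inside ∷ p}  {outside ∷ q} p⊆q with () ← p⊆q here
∣p∣+∣q─p∣≤∣q∣ {p = outside ∷ p} {inside ∷ q}  p⊆q =
  subst (_≤ suc ∣ q ∣) (sym (ℕₚ.+-suc ∣ p ∣ _)) (s≤s (∣p∣+∣q─p∣≤∣q∣ (drop-∷-⊆ p⊆q)))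
∣p∣+∣q─p∣≤∣q∣ {p = outside ∷ p} {outside ∷ q} p⊆q = ∣p∣+∣q─p∣≤∣q∣ (drop-∷-⊆ p⊆q)

everywhere : ∀ {n l} (x : Vec (Fin n) l) → InG ⊤ x
everywhere = All.universal (λ _ → ∈⊤)

toSet-All : ∀ {n l} {P : Fin n → Set} (v : Vec (Fin n) l) → All P v → ∀ {x} → x ∈ toSet v → P x
toSet-All []      []         x∈∅  = contradiction x∈∅ ∉⊥
toSet-All (y ∷ v) (py ∷ pv) x∈yv with x∈p∪q⁻ ⁅ y ⁆ (toSet v) x∈yv
... | inj₁ x∈⁅y⁆ rewrite x∈⁅y⁆⇒x≡y y x∈⁅y⁆ = py
... | inj₂ x∈v = toSet-All v pv x∈v

∈-toSet : ∀ {n l} {x : Fin n} {v : Vec (Fin n) l} → x ∈ᵥ v → x ∈ toSet v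
∈-toSet {x = x} {_ ∷ v} (Any.here refl) = p⊆p∪q (toSet v) (x∈⁅x⁆ x)
∈-toSet {v = y ∷ _}     (Any.there x∈v) = q⊆p∪q ⁅ y ⁆ _ (∈-toSet x∈v)

∣toSet∣≤length : ∀ {n l} (v : Vec (Fin n) l) → ∣ toSet v ∣ ≤ l
∣toSet∣≤length {n} []      = ≤-reflexive (∣⊥∣≡0 n)
∣toSet∣≤length     (x ∷ v) = ≤-trans (∣p∪q∣≤∣p∣+∣q∣ ⁅ x ⁆ (toSet v))
  (≤-trans (≤-reflexive (cong (_+ ∣ toSet v ∣) (∣⁅x⁆∣≡1 x))) (s≤s (∣toSet∣≤length v)))

toSet-++ : ∀ {n a b} (u : Vec (Fin n) a) (w : Vec (Fin n) b) → toSet (u ++ w) ≡ toSet u ∪ toSet w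
toSet-++ []      w = sym (∪-identityˡ (toSet w))
toSet-++ (x ∷ u) w = trans (cong (⁅ x ⁆ ∪_) (toSet-++ u w)) (sym (∪-assoc ⁅ x ⁆ (toSet u) (toSet w)))

toSet-cast : ∀ {n a b} (eq : a ≡ b) (v : Vec (Fin n) a) → toSet (cast eq v) ≡ toSet v
toSet-cast refl v = cong toSet (cast-is-id refl v)

removeAt-++ : ∀ {A : Set} {a b} (y : Vec A (suc a)) (w : Vec A b) (i : Fin (suc a)) →
              removeAt (y ++ w) (i ↑ˡ b) ≡ removeAt y i ++ w
removeAt-++             (x ∷ y)     w Fin.zero    = refl
removeAt-++ {a = suc a} (x ∷ z ∷ y) w (Fin.suc i) = cong (x ∷_) (removeAt-++ (z ∷ y) w i)

All-removeAt : ∀ {A : Set} {P : A → Set} {l} {v : Vec A (suc l)} → All P v → ∀ i → All P (removeAt v i)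
All-removeAt             (p ∷ ps)     Fin.zero    = ps
All-removeAt {l = suc l} (p ∷ q ∷ ps) (Fin.suc i) = p ∷ All-removeAt (q ∷ ps) i

fin-++-elim : ∀ {a b} (P : Fin (a + b) → Set) →
              (∀ i → P (i ↑ˡ b)) → (∀ j → P (a ↑ʳ j)) → ∀ I → P I
fin-++-elim {a} {b} P left right I = subst P (join-splitAt a b I) (by-side (splitAt a I))
  where
    by-side : ∀ side → P (join a b side)
    by-side (inj₁ i) = left i
    by-side (inj₂ j) = right j

sumℤ-allFin : ∀ {N} (g : Fin N → ℤ) → sumℤ (List.map g (List.allFin N)) ≡ sum g
sumℤ-allFin g = trans (cong sumℤ (map-tabulate (λ i → i) g)) (tabulated g)
  where
    tabulated : ∀ {N} (g : Fin N → ℤ) → sumℤ (List.tabulate g) ≡ sum g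
    tabulated {zero}  g = refl
    tabulated {suc N} g = cong (ℤ._+_ (g Fin.zero)) (tabulated (g ∘ Fin.suc))

sum-++ : ∀ a {b} (g : Fin (a + b) → ℤ) →
         sum g ≡ sum (λ i → g (i ↑ˡ b)) ℤ.+ sum (λ j → g (a ↑ʳ j))
sum-++ zero    g = sym (ℤₚ.+-identityˡ (sum g))
sum-++ (suc a) g = trans (cong (ℤ._+_ (g Fin.zero)) (sum-++ a (g ∘ Fin.suc)))
                         (sym (ℤₚ.+-assoc (g Fin.zero) _ _))

self-negative⇒zero : ∀ (z : ℤ) → z ≡ - z → z ≡ + 0
self-negative⇒zero (+ zero)  _ = refl
self-negative⇒zero (+ suc _) ()
self-negative⇒zero -[1+ _ ]  ()

cancel-square : ∀ z D → D ≢ + 0 → z * (D * D) ≡ + 0 → z ≡ + 0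
cancel-square z D D≢0 z·D²≡0 with ℤₚ.i*j≡0⇒i≡0∨j≡0 z z·D²≡0
... | inj₁ z≡0  = z≡0
... | inj₂ D²≡0 with ℤₚ.i*j≡0⇒i≡0∨j≡0 D D²≡0
...   | inj₁ D≡0 = contradiction D≡0 D≢0
...   | inj₂ D≡0 = contradiction D≡0 D≢0

scaled : ∀ c a b → c * + a * + b ≡ c * + (a ℕ.* b)
scaled c a b = trans (ℤₚ.*-assoc c (+ a) (+ b)) (cong (c *_) (sym (ℤₚ.pos-* a b)))

rescale-summand : ∀ σ p P P′ q Q Q′ D C → p * P * D ≡ p * P′ * C → q * Q * D ≡ q * Q′ * C →
                  σ * p * P * q * Q * (D * D) ≡ σ * p * P′ * q * Q′ * (C * C)
rescale-summand σ p P P′ q Q Q′ D C first second = begin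
    σ * p * P * q * Q * (D * D)         ≡⟨ regroup σ p P q Q D ⟩
    σ * (p * P * D) * (q * Q * D)       ≡⟨ cong₂ (λ u w → σ * u * w) first second ⟩
    σ * (p * P′ * C) * (q * Q′ * C)     ≡⟨ regroup σ p P′ q Q′ C ⟨
    σ * p * P′ * q * Q′ * (C * C)       ∎
  where
    open ≡-Reasoning
    regroup : ∀ σ p P q Q D → σ * p * P * q * Q * (D * D) ≡ σ * (p * P * D) * (q * Q * D)
    regroup = solve-∀

Alternating : ∀ {n} r → (Vec (Fin n) r → ℤ) → Set
Alternating {n} r χ = ∀ (x : Vec (Fin n) r) (i j : Fin r) → i ≢ j →
  χ ((x [ i ]≔ lookup x j) [ j ]≔ lookup x i) ≡ - χ x

alternating-repeat : ∀ {n r} {χ : Vec (Fin n) r → ℤ} → Alternating r χ →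
                     ∀ v i j → i ≢ j → lookup v i ≡ lookup v j → χ v ≡ + 0
alternating-repeat {χ = χ} alt v i j i≢j vᵢ≡vⱼ =
  self-negative⇒zero (χ v) (trans (cong χ (sym swap-is-id)) (alt v i j i≢j))
  where
    open ≡-Reasoning
    swap-is-id : (v [ i ]≔ lookup v j) [ j ]≔ lookup v i ≡ v
    swap-is-id = begin
      (v [ i ]≔ lookup v j) [ j ]≔ lookup v i  ≡⟨ cong (λ w → (v [ i ]≔ w) [ j ]≔ lookup v i) vᵢ≡vⱼ ⟨
      (v [ i ]≔ lookup v i) [ j ]≔ lookup v i  ≡⟨ cong (_[ j ]≔ lookup v i) ([]≔-lookup v i) ⟩
      v [ j ]≔ lookup v i                      ≡⟨ cong (v [ j ]≔_) vᵢ≡vⱼ ⟩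
      v [ j ]≔ lookup v j                      ≡⟨ []≔-lookup v j ⟩
      v                                        ∎

module Rank {n} {rk : Subset n → ℕ} (M : IsMatroid ⊤ rk) where
  open IsMatroid M

  mono : ∀ {X Y} → X ⊆ Y → rk X ≤ rk Y
  mono {X} {Y} = rk-mono X Y ⊆⊤

  rk≤card : ∀ X → rk X ≤ ∣ X ∣
  rk≤card X = rk-bounded X ⊆⊤

  rk-∅ : rk ∅ ≡ 0
  rk-∅ = ℕₚ.n≤0⇒n≡0 (≤-trans (rk≤card ∅) (≤-reflexive (∣⊥∣≡0 n)))

  rk-∪-≤ : ∀ X Y → rk (X ∪ Y) ≤ rk X + ∣ Y ∣
  rk-∪-≤ X Y = ≤-trans (ℕₚ.m≤m+n _ _)
    (≤-trans (rk-submod X Y ⊆⊤ ⊆⊤) (ℕₚ.+-monoʳ-≤ (rk X) (rk≤card Y)))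

  rk-squeeze : ∀ {X Y W} → X ⊆ Y → Y ⊆ W → rk X ≡ rk W → rk Y ≡ rk W
  rk-squeeze X⊆Y Y⊆W rkX≡rkW = ≤-antisym (mono Y⊆W) (≤-trans (≤-reflexive (sym rkX≡rkW)) (mono X⊆Y))

  Spans : Subset n → Subset n → Set
  Spans X P = rk (P ∪ X) ≡ rk X

  spans-⊆ : ∀ {X P} → P ⊆ X → Spans X P
  spans-⊆ P⊆X = cong rk (⊆⇒∪≡ P⊆X)

  spans-antitone : ∀ {X P Q} → Q ⊆ P → Spans X P → Spans X Q
  spans-antitone {X} {P} {Q} Q⊆P sp =
    trans (rk-squeeze (q⊆p∪q Q X) (∪-mono Q⊆P ⊆-refl) (sym sp)) sp

  -- Spanning is inherited by supersets (the submodular inequality).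
  spans-mono : ∀ {X X′ P} → X ⊆ X′ → Spans X P → Spans X′ P
  spans-mono {X} {X′} {P} X⊆X′ sp = ≤-antisym upper (mono (q⊆p∪q P X′))
    where
      open ℕₚ.≤-Reasoning
      upper : rk (P ∪ X′) ≤ rk X′
      upper = ℕₚ.+-cancelˡ-≤ (rk X) _ _ (begin
        rk X + rk (P ∪ X′)                ≡⟨ ℕₚ.+-comm (rk X) _ ⟩
        rk (P ∪ X′) + rk X                ≡⟨ cong (λ Y → rk Y + rk X)
                                               (trans (∪-assoc P X X′) (cong (P ∪_) (⊆⇒∪≡ X⊆X′))) ⟨
        rk ((P ∪ X) ∪ X′) + rk X          ≤⟨ ℕₚ.+-monoʳ-≤ _ (mono (λ x∈X → x∈p∩q⁺ (q⊆p∪q P X x∈X , X⊆X′ x∈X))) ⟩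
        rk ((P ∪ X) ∪ X′) + rk ((P ∪ X) ∩ X′)  ≤⟨ rk-submod (P ∪ X) X′ ⊆⊤ ⊆⊤ ⟩
        rk (P ∪ X) + rk X′                ≡⟨ cong (_+ rk X′) sp ⟩
        rk X + rk X′                      ∎)

  spans-∪ : ∀ {X P Q} → Spans X P → Spans X Q → Spans X (P ∪ Q)
  spans-∪ {X} {P} {Q} spP spQ = begin
    rk ((P ∪ Q) ∪ X)   ≡⟨ cong rk (trans (cong (_∪ X) (∪-comm P Q)) (∪-assoc Q P X)) ⟩
    rk (Q ∪ (P ∪ X))   ≡⟨ spans-mono (q⊆p∪q P X) spQ ⟩
    rk (P ∪ X)         ≡⟨ spP ⟩
    rk X               ∎
    where open ≡-Reasoning

  rank-step : ∀ {e X} → ¬ Spans X ⁅ e ⁆ → rk (⁅ e ⁆ ∪ X) ≡ suc (rk X)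
  rank-step {e} {X} new = ≤-antisym upper (ℕₚ.≤∧≢⇒< (mono (q⊆p∪q ⁅ e ⁆ X)) (new ∘ sym))
    where
      open ℕₚ.≤-Reasoning
      upper : rk (⁅ e ⁆ ∪ X) ≤ suc (rk X)
      upper = begin
        rk (⁅ e ⁆ ∪ X)      ≡⟨ cong rk (∪-comm ⁅ e ⁆ X) ⟩
        rk (X ∪ ⁅ e ⁆)      ≤⟨ rk-∪-≤ X ⁅ e ⁆ ⟩
        rk X + ∣ ⁅ e ⁆ ∣    ≡⟨ cong (_+_ (rk X)) (∣⁅x⁆∣≡1 e) ⟩
        rk X + 1            ≡⟨ ℕₚ.+-comm (rk X) 1 ⟩
        suc (rk X)          ∎

  basis-closure : ∀ {Z S} → Z ⊆ S → rk Z ≡ rk S → ∀ Q → rk (Z ∪ Q) ≡ rk (S ∪ Q)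
  basis-closure {Z} {S} Z⊆S rkZ≡rkS Q =
    trans (sym (spans-mono (p⊆p∪q Q) Z-spans-S))
          (cong rk (trans (sym (∪-assoc S Z Q)) (cong (_∪ Q) S∪Z≡S)))
    where
      S∪Z≡S : S ∪ Z ≡ S
      S∪Z≡S = trans (∪-comm S Z) (⊆⇒∪≡ Z⊆S)
      Z-spans-S : Spans Z S
      Z-spans-S = trans (cong rk S∪Z≡S) (sym rkZ≡rkS)

  independent-over-⊆ : ∀ {X Y Y′} → rk (X ∪ Y) ≡ rk X + ∣ Y ∣ → Y′ ⊆ Y →
                       rk (X ∪ Y′) ≡ rk X + ∣ Y′ ∣
  independent-over-⊆ {X} {Y} {Y′} indep Y′⊆Y = ≤-antisym (rk-∪-≤ X Y′) lower
    where
      open ℕₚ.≤-Reasoning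
      D : Subset n
      D = Y ─ Y′
      cover : X ∪ Y ⊆ (X ∪ Y′) ∪ D
      cover = ∪-lub (λ x∈X → p⊆p∪q D (p⊆p∪q Y′ x∈X)) by-membership
        where
          by-membership : Y ⊆ (X ∪ Y′) ∪ D
          by-membership {x} x∈Y with x ∈? Y′
          ... | yes x∈Y′ = p⊆p∪q D (q⊆p∪q X Y′ x∈Y′)
          ... | no  x∉Y′ = q⊆p∪q (X ∪ Y′) D (x∈p∧x∉q⇒x∈p─q x∈Y x∉Y′)
      lower : rk X + ∣ Y′ ∣ ≤ rk (X ∪ Y′)
      lower = ℕₚ.+-cancelʳ-≤ ∣ D ∣ _ _ (begin
        rk X + ∣ Y′ ∣ + ∣ D ∣      ≡⟨ ℕₚ.+-assoc (rk X) _ _ ⟩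
        rk X + (∣ Y′ ∣ + ∣ D ∣)    ≤⟨ ℕₚ.+-monoʳ-≤ (rk X) (∣p∣+∣q─p∣≤∣q∣ Y′⊆Y) ⟩
        rk X + ∣ Y ∣               ≡⟨ indep ⟨
        rk (X ∪ Y)                 ≤⟨ mono cover ⟩
        rk ((X ∪ Y′) ∪ D)          ≤⟨ rk-∪-≤ (X ∪ Y′) D ⟩
        rk (X ∪ Y′) + ∣ D ∣        ∎)

  record IndependentSpanning (Y P : Subset n) : Set where
    constructor independent-spanning
    field
      size        : ℕ
      tuple       : Vec (Fin n) size
      tuple⊆Y     : All (_∈ Y) tuple
      independent : rk (toSet tuple) ≡ size
      spanning    : Spans (toSet tuple) P

  weaken : ∀ {Y P Q} → Q ⊆ P → IndependentSpanning Y P → IndependentSpanning Y Q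
  weaken Q⊆P (independent-spanning l v v⊆Y ind sp) =
    independent-spanning l v v⊆Y ind (spans-antitone Q⊆P sp)

  adjoin : ∀ {Y P e} → e ∈ Y → IndependentSpanning Y P → IndependentSpanning Y (⁅ e ⁆ ∪ P)
  adjoin {e = e} e∈Y (independent-spanning l v v⊆Y ind sp) with rk (⁅ e ⁆ ∪ toSet v) ℕₚ.≟ rk (toSet v)
  ... | yes spanned = independent-spanning l v v⊆Y ind (spans-∪ spanned sp)
  ... | no  new     = independent-spanning (suc l) (e ∷ v) (e∈Y ∷ v⊆Y)
      (trans (rank-step new) (cong suc ind))
      (spans-∪ (spans-⊆ (p⊆p∪q (toSet v))) (spans-mono (q⊆p∪q ⁅ e ⁆ (toSet v)) sp))

  greedy : ∀ {Y N} (L : Vec (Fin n) N) → IndependentSpanning Y (Y ∩ toSet L)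
  greedy []  = independent-spanning 0 [] [] rk-∅ (spans-⊆ (p∩q⊆q _ ∅))
  greedy {Y} (e ∷ L) with e ∈? Y
  ... | yes e∈Y = weaken keep-e (adjoin e∈Y (greedy L))
    where
      keep-e : Y ∩ (⁅ e ⁆ ∪ toSet L) ⊆ ⁅ e ⁆ ∪ (Y ∩ toSet L)
      keep-e x∈ with x∈p∩q⁻ Y _ x∈
      ... | x∈Y , x∈eL = [ p⊆p∪q _ , (λ x∈L → q⊆p∪q ⁅ e ⁆ _ (x∈p∩q⁺ (x∈Y , x∈L))) ]′
                           (x∈p∪q⁻ ⁅ e ⁆ (toSet L) x∈eL)
  ... | no  e∉Y = weaken drop-e (greedy L)
    where
      drop-e : Y ∩ (⁅ e ⁆ ∪ toSet L) ⊆ Y ∩ toSet L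
      drop-e x∈ with x∈p∩q⁻ Y _ x∈
      ... | x∈Y , x∈eL = [ (λ x∈⁅e⁆ → contradiction (subst (_∈ Y) (x∈⁅y⁆⇒x≡y e x∈⁅e⁆) x∈Y) e∉Y)
                         , (λ x∈L → x∈p∩q⁺ (x∈Y , x∈L)) ]′ (x∈p∪q⁻ ⁅ e ⁆ (toSet L) x∈eL)

  BasisTuple : Subset n → Set
  BasisTuple Y = Σ (Vec (Fin n) (rk Y)) λ z → All (_∈ Y) z × IsBasis Y rk (toSet z)

  -- Every subset has a basis tuple: run the greedy step over all of Fin n.
  basis-tuple : ∀ Y → BasisTuple Y
  basis-tuple Y = from-greedy (weaken (λ x∈Y → x∈p∩q⁺ (x∈Y , ∈-toSet (∈-allFin⁺ _)))
                                      (greedy (Vec.allFin n)))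
    where
      as-basis : ∀ {l} (v : Vec (Fin n) l) → l ≡ rk Y → All (_∈ Y) v → rk (toSet v) ≡ rk Y →
                 BasisTuple Y
      as-basis v refl v⊆Y rkV≡rkY = v , v⊆Y , toSet-All v v⊆Y
        , ≤-antisym (∣toSet∣≤length v) (≤-trans (≤-reflexive (sym rkV≡rkY)) (rk≤card _)) , rkV≡rkY
      from-greedy : IndependentSpanning Y Y → BasisTuple Y
      from-greedy (independent-spanning l v v⊆Y ind sp) = as-basis v (trans (sym ind) rkV≡rkY) v⊆Y rkV≡rkY
        where
          rkV≡rkY : rk (toSet v) ≡ rk Y
          rkV≡rkY = trans (sym sp) (cong rk (trans (∪-comm Y (toSet v)) (⊆⇒∪≡ (toSet-All v v⊆Y))))

module _ {n} {G H : Subset n} {rk : Subset n → ℕ} (H⊆G : H ⊆ G) where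

  restrict-matroid : IsMatroid G rk → IsMatroid H rk
  restrict-matroid M = record
    { rk-bounded = λ X X⊆H → rk-bounded X (⊆-trans X⊆H H⊆G)
    ; rk-mono    = λ X Y Y⊆H → rk-mono X Y (⊆-trans Y⊆H H⊆G)
    ; rk-submod  = λ X Y X⊆H Y⊆H → rk-submod X Y (⊆-trans X⊆H H⊆G) (⊆-trans Y⊆H H⊆G) }
    where open IsMatroid M

  enlarge-molecule : ∀ {R F T} → IsMolecule H rk R F T → IsMolecule G rk R F T
  enlarge-molecule mol = record
    { R⊆G = ⊆-trans R⊆G H⊆G ; F⊆G = ⊆-trans F⊆G H⊆G ; T⊆G = ⊆-trans T⊆G H⊆G
    ; RF-disj = RF-disj ; RT-disj = RT-disj ; FT-disj = FT-disj ; rank-cond = rank-cond }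
    where open IsMolecule mol

  restrict-arithmetic : ∀ {m} → IsArithmeticMatroid G rk m → IsArithmeticMatroid H rk m
  restrict-arithmetic AM = record
    { matroid  = restrict-matroid matroid
    ; m-pos    = λ X X⊆H → m-pos X (⊆-trans X⊆H H⊆G)
    ; A1-dep   = λ X e X⊆H e∈H → A1-dep X e (⊆-trans X⊆H H⊆G) (H⊆G e∈H)
    ; A1-indep = λ X e X⊆H e∈H → A1-indep X e (⊆-trans X⊆H H⊆G) (H⊆G e∈H)
    ; A2       = λ R F T mol → A2 R F T (enlarge-molecule mol)
    ; P        = λ R F T mol → P R F T (enlarge-molecule mol) }
    where open IsArithmeticMatroid AM

module Deletion {n} {rk m : Subset n → ℕ} (AM : IsArithmeticMatroid ⊤ rk m)
                (S : Subset n) {k} (f : Vec (Fin n) k) (f∉S : All (_∉ S) f)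
                (rank-sum : rk S + k ≡ rk ⊤) (S∪F-spans : rk (S ∪ toSet f) ≡ rk ⊤) where
  open IsArithmeticMatroid AM
  open Rank matroid

  F : Subset n
  F = toSet f

  ∣F∣≡k : ∣ F ∣ ≡ k
  ∣F∣≡k = ≤-antisym (∣toSet∣≤length f) (ℕₚ.+-cancelˡ-≤ (rk S) _ _ (begin
    rk S + k        ≡⟨ trans rank-sum (sym S∪F-spans) ⟩
    rk (S ∪ F)      ≤⟨ rk-∪-≤ S F ⟩
    rk S + ∣ F ∣    ∎))
    where open ℕₚ.≤-Reasoning

  F-independent : rk (S ∪ F) ≡ rk S + ∣ F ∣
  F-independent = trans S∪F-spans (trans (sym rank-sum) (cong (_+_ (rk S)) (sym ∣F∣≡k)))

  basis-restrict : ∀ {Z} → Z ⊆ S → ∣ Z ∣ ≤ rk S → rk (Z ∪ F) ≡ rk ⊤ → IsBasis S rk Z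
  basis-restrict {Z} Z⊆S ∣Z∣≤rkS Z∪F-spans =
    Z⊆S , ≤-antisym ∣Z∣≤rkS (≤-trans rkS≤rkZ (rk≤card Z)) , ≤-antisym (mono Z⊆S) rkS≤rkZ
    where
      open ℕₚ.≤-Reasoning
      rkS≤rkZ : rk S ≤ rk Z
      rkS≤rkZ = ℕₚ.+-cancelʳ-≤ k _ _ (begin
        rk S + k        ≡⟨ trans rank-sum (sym Z∪F-spans) ⟩
        rk (Z ∪ F)      ≤⟨ rk-∪-≤ Z F ⟩
        rk Z + ∣ F ∣    ≡⟨ cong (_+_ (rk Z)) ∣F∣≡k ⟩
        rk Z + k        ∎)

  basis-extend : ∀ {Z} → IsBasis S rk Z → IsBasis ⊤ rk (Z ∪ F)
  basis-extend {Z} (Z⊆S , ∣Z∣≡rkS , rkZ≡rkS) = ⊆⊤ , ≤-antisym card≤ rk≤ , Z∪F-spans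
    where
      open ℕₚ.≤-Reasoning
      Z∪F-spans : rk (Z ∪ F) ≡ rk ⊤
      Z∪F-spans = trans (basis-closure Z⊆S rkZ≡rkS F) S∪F-spans
      card≤ : ∣ Z ∪ F ∣ ≤ rk ⊤
      card≤ = begin
        ∣ Z ∪ F ∣       ≤⟨ ∣p∪q∣≤∣p∣+∣q∣ Z F ⟩
        ∣ Z ∣ + ∣ F ∣   ≡⟨ cong₂ _+_ ∣Z∣≡rkS ∣F∣≡k ⟩
        rk S + k        ≡⟨ rank-sum ⟩
        rk ⊤            ∎
      rk≤ : rk ⊤ ≤ ∣ Z ∪ F ∣
      rk≤ = ≤-trans (≤-reflexive (sym Z∪F-spans)) (rk≤card (Z ∪ F))

  F-avoids-S : ∀ {x} → x ∈ F → x ∉ S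
  F-avoids-S = toSet-All f f∉S

  -- For a basis Z of S, the triple (Z, F, S ∖ Z) is a molecule; axiom (A2)
  -- for it relates the multiplicities of Z, Z ∪ F, S and S ∪ F.
  module _ {Z} (Z⊆S : Z ⊆ S) (rkZ≡rkS : rk Z ≡ rk S) where
    T : Subset n
    T = S ∩ ∁ Z

    T⊆S : T ⊆ S
    T⊆S = p∩q⊆p S (∁ Z)

    Z∪T≡S : Z ∪ T ≡ S
    Z∪T≡S = ⊆-antisym (∪-lub Z⊆S T⊆S) split
      where
        split : S ⊆ Z ∪ T
        split {x} x∈S with x ∈? Z
        ... | yes x∈Z = p⊆p∪q T x∈Z
        ... | no  x∉Z = q⊆p∪q Z T (x∈p∩q⁺ (x∈S , x∉p⇒x∈∁p x∉Z))

    Z∪F∪T≡S∪F : Z ∪ F ∪ T ≡ S ∪ F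
    Z∪F∪T≡S∪F = begin
      Z ∪ (F ∪ T)   ≡⟨ cong (Z ∪_) (∪-comm F T) ⟩
      Z ∪ (T ∪ F)   ≡⟨ ∪-assoc Z T F ⟨
      (Z ∪ T) ∪ F   ≡⟨ cong (_∪ F) Z∪T≡S ⟩
      S ∪ F         ∎
      where open ≡-Reasoning

    basis-molecule : IsMolecule ⊤ rk Z F T
    basis-molecule = record
      { R⊆G = ⊆⊤ ; F⊆G = ⊆⊤ ; T⊆G = ⊆⊤
      ; RF-disj = disjoint⇒∩≡∅ λ x∈Z x∈F → F-avoids-S x∈F (Z⊆S x∈Z)
      ; RT-disj = disjoint⇒∩≡∅ λ x∈Z x∈T → x∈∁p⇒x∉p (proj₂ (x∈p∩q⁻ S (∁ Z) x∈T)) x∈Z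
      ; FT-disj = disjoint⇒∩≡∅ λ x∈F x∈T → F-avoids-S x∈F (T⊆S x∈T)
      ; rank-cond = rank-cond }
      where
        -- Z ∪ F′ ∪ T′ lies between Z ∪ F′ and S ∪ F′, which have equal rank.
        rank-cond : ∀ F′ T′ → F′ ⊆ F → T′ ⊆ T → rk (Z ∪ F′ ∪ T′) ≡ rk Z + ∣ F′ ∣
        rank-cond F′ T′ F′⊆F T′⊆T = begin
          rk (Z ∪ F′ ∪ T′)   ≡⟨ rk-squeeze (∪-mono ⊆-refl (p⊆p∪q T′))
                                  (∪-lub (λ x∈Z → p⊆p∪q F′ (Z⊆S x∈Z))
                                         (∪-lub (q⊆p∪q S F′) (λ x∈T′ → p⊆p∪q F′ (T⊆S (T′⊆T x∈T′)))))
                                  (basis-closure Z⊆S rkZ≡rkS F′) ⟩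
          rk (S ∪ F′)        ≡⟨ independent-over-⊆ F-independent F′⊆F ⟩
          rk S + ∣ F′ ∣      ≡⟨ cong (_+ ∣ F′ ∣) rkZ≡rkS ⟨
          rk Z + ∣ F′ ∣      ∎
          where open ≡-Reasoning

    multiplicity-ratio : m Z ℕ.* m (S ∪ F) ≡ m (Z ∪ F) ℕ.* m S
    multiplicity-ratio = begin
      m Z ℕ.* m (S ∪ F)           ≡⟨ cong (λ X → m Z ℕ.* m X) Z∪F∪T≡S∪F ⟨
      m Z ℕ.* m (Z ∪ F ∪ T)       ≡⟨ A2 Z F T basis-molecule ⟩
      m (Z ∪ F) ℕ.* m (Z ∪ T)     ≡⟨ cong (λ X → m (Z ∪ F) ℕ.* m X) Z∪T≡S ⟩
      m (Z ∪ F) ℕ.* m S           ∎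
      where open ≡-Reasoning

  rescaling : ∀ c Z → Z ⊆ S → (c ≢ + 0 → rk Z ≡ rk S) →
              c * + m Z * + m (S ∪ F) ≡ c * + m (Z ∪ F) * + m S
  rescaling c Z Z⊆S basis-if-nonzero with c ℤ.≟ + 0
  ... | yes refl = refl
  ... | no  c≢0  = trans (scaled c (m Z) (m (S ∪ F)))
      (trans (cong (λ u → c * + u) (multiplicity-ratio Z⊆S (basis-if-nonzero c≢0)))
             (sym (scaled c (m (Z ∪ F)) (m S))))

  multiplicity-nonzero : ∀ X → + m X ≢ + 0
  multiplicity-nonzero X mX≡0 = contradiction (subst (1 ≤_) (ℤₚ.+-injective mX≡0) (m-pos X ⊆⊤)) λ ()

  module Oriented (χ : Vec (Fin n) (rk ⊤) → ℤ) (underlying : UnderlyingMatroid ⊤ rk χ) where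
    χ∖ : Vec (Fin n) (rk S) → ℤ
    χ∖ = deleteχ rank-sum f χ

    entries : ∀ x → toSet (cast rank-sum (x ++ f)) ≡ toSet x ∪ F
    entries x = trans (toSet-cast rank-sum (x ++ f)) (toSet-++ x f)

    nonzero⇒basis : ∀ x → InG S x → χ∖ x ≢ + 0 → IsBasis S rk (toSet x)
    nonzero⇒basis x x∈S nz = basis-restrict (toSet-All x x∈S) (∣toSet∣≤length x)
      (subst (λ B → rk B ≡ rk ⊤) (entries x)
        (proj₂ (proj₂ (proj₁ (underlying (cast rank-sum (x ++ f)) (everywhere _)) nz))))

    basis⇒nonzero : ∀ x → InG S x → IsBasis S rk (toSet x) → χ∖ x ≢ + 0
    basis⇒nonzero x x∈S basis = proj₂ (underlying (cast rank-sum (x ++ f)) (everywhere _))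
      (subst (IsBasis ⊤ rk) (sym (entries x)) (basis-extend basis))

    deleted-underlying : UnderlyingMatroid S rk χ∖
    deleted-underlying x x∈S = nonzero⇒basis x x∈S , basis⇒nonzero x x∈S

    deleted-nonzero : ∃ λ x → InG S x × χ∖ x ≢ + 0
    deleted-nonzero with basis-tuple S
    ... | z , z∈S , basis = z , z∈S , basis⇒nonzero z z∈S basis

    deleted-rescaling : ∀ a → InG S a →
      χ∖ a * + m (toSet a) * + m (S ∪ F) ≡ χ∖ a * + m (toSet a ∪ F) * + m S
    deleted-rescaling a a∈S = rescaling (χ∖ a) (toSet a) (toSet-All a a∈S)
      (λ nz → proj₂ (proj₂ (nonzero⇒basis a a∈S nz)))

module Append {n k} (f : Vec (Fin n) k) where

  appended : ∀ {s} (χ : Vec (Fin n) (s + k) → ℤ) x → deleteχ refl f χ x ≡ χ (x ++ f)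
  appended χ x = cong χ (cast-is-id refl (x ++ f))

  -- Moving an entry of f to the front produces a repeated entry.
  padding-repeats : ∀ {s} {χ : Vec (Fin n) (suc s + k) → ℤ} → Alternating (suc s + k) χ →
                    ∀ (xs : Vec (Fin n) s) j → χ (lookup f j ∷ (xs ++ f)) ≡ + 0
  padding-repeats alt xs j = alternating-repeat alt (lookup f j ∷ (xs ++ f))
    Fin.zero (Fin.suc (_ ↑ʳ j)) (λ ()) (sym (lookup-++ʳ xs f j))

  -- Swaps inside x are swaps inside x ++ f.
  alternating-deletion : ∀ {s r} {χ : Vec (Fin n) r → ℤ} (eq : s + k ≡ r) →
                         Alternating r χ → Alternating s (deleteχ eq f χ)
  alternating-deletion {χ = χ} refl alt x i j i≢j = begin
      deleteχ refl f χ ((x [ i ]≔ lookup x j) [ j ]≔ lookup x i)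
    ≡⟨ appended χ _ ⟩
      χ (((x [ i ]≔ lookup x j) [ j ]≔ lookup x i) ++ f)
    ≡⟨ cong χ swap-++ ⟨
      χ (((x ++ f) [ i ↑ˡ k ]≔ lookup (x ++ f) (j ↑ˡ k)) [ j ↑ˡ k ]≔ lookup (x ++ f) (i ↑ˡ k))
    ≡⟨ alt (x ++ f) (i ↑ˡ k) (j ↑ˡ k) (i≢j ∘ ↑ˡ-injective k i j) ⟩
      - χ (x ++ f)
    ≡⟨ cong -_ (appended χ x) ⟨
      - deleteχ refl f χ x
    ∎
    where
      open ≡-Reasoning
      swap-++ : ((x ++ f) [ i ↑ˡ k ]≔ lookup (x ++ f) (j ↑ˡ k)) [ j ↑ˡ k ]≔ lookup (x ++ f) (i ↑ˡ k)
                ≡ ((x [ i ]≔ lookup x j) [ j ]≔ lookup x i) ++ f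
      swap-++ rewrite lookup-++ˡ x f j | lookup-++ˡ x f i | []≔-++-↑ˡ {x = lookup x j} x f i
                    | []≔-++-↑ˡ {x = lookup x i} (x [ i ]≔ lookup x j) f j = refl

  -- Exchange for χ (x ++ f) is exchange for χ at (x ++ f, y ++ f): the
  -- positions of f contribute products with a vanishing factor.
  exchange-deletion : ∀ {s r} {G : Subset n} {χ : Vec (Fin n) r → ℤ} (eq : s + k ≡ r) →
                      Alternating r χ → Exchange ⊤ r χ → Exchange G s (deleteχ eq f χ)
  exchange-deletion {zero}          _    _   _        = tt
  exchange-deletion {suc s} {χ = χ} refl alt exchange (x₀ ∷ xs) y _ _ hyp =
    subst₂ (λ u w → + 0 ℤ.≤ u * w) (sym (appended χ (x₀ ∷ xs))) (sym (appended χ y))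
      (exchange (x₀ ∷ (xs ++ f)) (y ++ f) (everywhere _) (everywhere _)
        (fin-++-elim (λ I → + 0 ℤ.≤ χ (lookup (y ++ f) I ∷ (xs ++ f)) * χ ((y ++ f) [ I ]≔ x₀))
                     from-hyp padding))
    where
      from-hyp : ∀ i → + 0 ℤ.≤ χ (lookup (y ++ f) (i ↑ˡ k) ∷ (xs ++ f)) * χ ((y ++ f) [ i ↑ˡ k ]≔ x₀)
      from-hyp i rewrite lookup-++ˡ y f i | []≔-++-↑ˡ {x = x₀} y f i =
        subst₂ (λ u w → + 0 ℤ.≤ u * w) (appended χ (lookup y i ∷ xs)) (appended χ (y [ i ]≔ x₀)) (hyp i)
      padding : ∀ j → + 0 ℤ.≤ χ (lookup (y ++ f) (suc s ↑ʳ j) ∷ (xs ++ f)) * χ ((y ++ f) [ suc s ↑ʳ j ]≔ x₀)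
      padding j rewrite lookup-++ʳ y f j | padding-repeats alt xs j = ℤₚ.≤-refl

  gp-term : ∀ {s} (m : Subset n → ℕ) (ψ : Vec (Fin n) (suc s) → ℤ) →
            Vec (Fin n) s → Vec (Fin n) (suc (suc s)) → Fin (suc (suc s)) → ℤ
  gp-term m ψ xs y i = sgnPow (toℕ i) * ψ (lookup y i ∷ xs) * + m (toSet (lookup y i ∷ xs))
                                      * ψ (removeAt y i) * + m (toSet (removeAt y i))

  -- The deleted relation follows from the original one, provided that
  -- χ (a ++ f) · m(a) · D = χ (a ++ f) · m(a ∪ F) · C for every tuple a in G,
  -- i.e. the multiplicities are proportional wherever χ does not vanish.
  gp-deletion : ∀ {s r} (G : Subset n) (m : Subset n → ℕ) {χ : Vec (Fin n) r → ℤ} (eq : s + k ≡ r)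
                (C D : ℤ) → D ≢ + 0 → Alternating r χ → GPRelation ⊤ r χ m →
                (∀ a → InG G a → deleteχ eq f χ a * + m (toSet a) * D
                                 ≡ deleteχ eq f χ a * + m (toSet a ∪ toSet f) * C) →
                GPRelation G s (deleteχ eq f χ) m
  gp-deletion {zero}  _ _ _ _ _ _ _ _ _ = tt
  gp-deletion {suc s} G m {χ} refl C D D≢0 alt gp rescale xs y xs∈G y∈G =
    trans (sumℤ-allFin t) (cancel-square (sum t) D D≢0 rescaled-sum)
    where
      open ≡-Reasoning
      t : Fin (suc (suc s)) → ℤ
      t = gp-term m (deleteχ refl f χ) xs y
      T : Fin (suc (suc s) + k) → ℤ
      T = gp-term m χ (xs ++ f) (y ++ f)

      rescale⁺ : ∀ a → InG G a → χ (a ++ f) * + m (toSet a) * D ≡ χ (a ++ f) * + m (toSet (a ++ f)) * C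
      rescale⁺ a a∈G = subst₂ (λ c Z → c * + m (toSet a) * D ≡ c * + m Z * C)
        (appended χ a) (sym (toSet-++ a f)) (rescale a a∈G)

      rescaled : ∀ i → t i * (D * D) ≡ T (i ↑ˡ k) * (C * C)
      rescaled i rewrite appended χ (lookup y i ∷ xs) | appended χ (removeAt y i)
                       | toℕ-↑ˡ i k | lookup-++ˡ y f i | removeAt-++ y f i =
        rescale-summand (sgnPow (toℕ i)) _ _ _ _ _ _ D C
          (rescale⁺ (lookup y i ∷ xs) (lookup⁺ y∈G i ∷ xs∈G))
          (rescale⁺ (removeAt y i) (All-removeAt y∈G i))

      padding : ∀ j → T (suc (suc s) ↑ʳ j) ≡ + 0
      padding j rewrite lookup-++ʳ y f j | padding-repeats alt xs j
                      | ℤₚ.*-zeroʳ (sgnPow (toℕ (suc (suc s) ↑ʳ j))) = refl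

      unpadded-sum : sum (λ i → T (i ↑ˡ k)) ≡ + 0
      unpadded-sum = begin
        sum (λ i → T (i ↑ˡ k))                                     ≡⟨ ℤₚ.+-identityʳ _ ⟨
        sum (λ i → T (i ↑ˡ k)) ℤ.+ + 0                             ≡⟨ cong (ℤ._+_ (sum (λ i → T (i ↑ˡ k)))) padded-sum ⟨
        sum (λ i → T (i ↑ˡ k)) ℤ.+ sum (λ j → T (suc (suc s) ↑ʳ j)) ≡⟨ sum-++ (suc (suc s)) T ⟨
        sum T                                                      ≡⟨ sumℤ-allFin T ⟨
        sumℤ (List.map T (List.allFin _))                          ≡⟨ gp (xs ++ f) (y ++ f) (everywhere _) (everywhere _) ⟩
        + 0                                                        ∎
        where
          padded-sum : sum (λ j → T (suc (suc s) ↑ʳ j)) ≡ + 0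
          padded-sum = trans (sum-cong-≗ padding) (sum-replicate-zero k)

      rescaled-sum : sum t * (D * D) ≡ + 0
      rescaled-sum = begin
        sum t * (D * D)                       ≡⟨ *-distribʳ-sum (D * D) t ⟩
        sum (λ i → t i * (D * D))             ≡⟨ sum-cong-≗ rescaled ⟩
        sum (λ i → T (i ↑ˡ k) * (C * C))      ≡⟨ *-distribʳ-sum (C * C) (λ i → T (i ↑ˡ k)) ⟨
        sum (λ i → T (i ↑ˡ k)) * (C * C)      ≡⟨ cong (_* (C * C)) unpadded-sum ⟩
        + 0                                   ∎

proposition2p1 : ∀ {n : ℕ} (rk : Subset n → ℕ) (χ : Vec (Fin n) (rk ⊤) → ℤ)
    (m : Subset n → ℕ) →
    IsOrientedArithmeticMatroid ⊤ rk χ m →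
    (A : Subset n) (k : ℕ) (eq : rk (∁ A) + k ≡ rk ⊤) (f : Vec (Fin n) k) →
    All (_∈ A) f →
    rk (∁ A ∪ toSet f) ≡ rk ⊤ →
    IsOrientedArithmeticMatroid (∁ A) rk (deleteχ eq f χ) m
proposition2p1 rk χ m O A k eq f f∈A spans = record
  { arithmetic = restrict-arithmetic ⊆⊤ arithmetic
  ; chirotope  = record
      { values      = λ x _ → values (cast eq (x ++ f)) (everywhere _)
      ; nonzero     = deleted-nonzero
      ; alternating = λ x _ → alternating-deletion eq alt x
      ; exchange    = exchange-deletion eq alt exchange }
  ; underlying = deleted-underlying
  ; gp         = gp-deletion (∁ A) m eq (+ m (∁ A)) (+ m (∁ A ∪ toSet f))
                   (multiplicity-nonzero _) alt gp deleted-rescaling }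
  where
    open IsOrientedArithmeticMatroid O
    open IsChirotope chirotope
    open Deletion arithmetic (∁ A) f (All.map x∈p⇒x∉∁p f∈A) eq spans
    open Oriented χ underlying
    open Append f
    alt : Alternating (rk ⊤) χ
    alt x = alternating x (everywhere x)
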